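{- Let $b\ge 2$ be an integer and define $(h_{1,b}(n))_{n\in\mathbb{N}}$ by $h_{1,b}(n)=1$ for integers $n\le 0$, $h_{1,b}(1)=b$, and $h_{1,b}(n)=h_{1,b}(n-h_{1,b}(n-1))+h_{1,b}(n-2)$ for $n>1$. Let $H_b(x)=\sum_{n=0}^\infty h_{1,b}(n)x^n$. Then $$H_b(x)=\frac{x}{1-x^2}H_b(x^2)+\frac{(b-1)x}{1-x^2}+\frac{1}{(1-x^2)^2}.$$
   Context: Identity of formal power series. -}

module Defs where

open import Data.Nat using (ℕ; zero; suc; _∸_; _≤_)
open import Data.Integer using (ℤ; +_; _+_; _-_; _*_; _>_) renaming (_≤_ to _≤ℤ_)
open import Relation.Binary.PropositionalEquality using (_≡_)
open import Relation.Nullary using (yes; no)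
open import Data.Product using (_×_)

Series : Set
Series = ℕ → ℤ

Σ≤ : ℕ → (ℕ → ℤ) → ℤ
Σ≤ zero    f = f 0
Σ≤ (suc n) f = Σ≤ n f + f (suc n)

_⊕_ : Series → Series → Series
(f ⊕ g) n = f n + g n

_⊗_ : Series → Series → Series
(f ⊗ g) n = Σ≤ n (λ i → f i * g (n ∸ i))

infixl 6 _⊕_
infixl 7 _⊗_

const : ℤ → Series
const c zero    = c
const c (suc _) = + 0

X : Series
X 1 = + 1
X _ = + 0

-- substitution x ↦ x², i.e. F(x) ↦ F(x²)
subst-x² : Series → Series
subst-x² f zero          = f 0
subst-x² f (suc zero)    = + 0
subst-x² f (suc (suc n)) = subst-x² (λ k → f (suc k)) n

one-x² : Series
one-x² 0 = + 1
one-x² 2 = Data.Integer.-_ (+ 1)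
one-x² _ = + 0

_≐_ : Series → Series → Set
f ≐ g = ∀ n → f n ≡ g n

infix 4 _≐_

IsH1 : ℕ → (ℤ → ℤ) → Set
IsH1 b h =
  (∀ n → n ≤ℤ + 0 → h n ≡ + 1) ×
  (h (+ 1) ≡ + b) ×
  (∀ n → n > + 1 → h n ≡ h (n - h (n - + 1)) + h (n - + 2))

genH : (ℤ → ℤ) → Series
genH h n = h (+ n)

{-# OPTIONS --safe #-}
-- Since G = 1/(1 − x²) = 1 + x² + x⁴ + ⋯, convolving with G sums every other coefficient, and the
-- right-hand side has coefficient 1 at x⁰, k + 2 at x^(2k+2) and (b − 1) + h(0) + ⋯ + h(k) at x^(2k+1).
-- So the identity says h(2k) = k + 1 and h(2k+1) = (b − 1) + Σ_{j≤k} h(j). The first holds together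
-- with h(2k+1) ≥ 2k + 2 by strong induction: that bound sends the first recursive call at 2k + 2 to a
-- non-positive index, so h(2k+2) = 1 + h(2k), and then the call at 2k + 3 lands at k + 1, so
-- h(2k+3) = h(k+1) + h(2k+1), which also gives the odd formula.
module Submission where

open import Defs
open import Data.Nat using (ℕ; _≤_)
open import Data.Integer using (ℤ; +_; _-_)
open import Data.Nat as ℕ using (zero; suc; _∸_; _<_; z≤n; s≤s)
import Data.Nat.Properties as ℕP
open import Data.Nat.Induction using (<-rec)
open import Data.Integer as ℤ using (_+_; _*_; -_)
import Data.Integer.Properties as ℤP
open import Data.Integer.Tactic.RingSolver using (solve-∀)
open import Data.Product using (_×_; _,_; proj₁; proj₂)
open import Function using (_∘_)
open import Relation.Binary.PropositionalEquality
open ≡-Reasoning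

Σ≤-cong : ∀ n {f g : ℕ → ℤ} → (∀ i → f i ≡ g i) → Σ≤ n f ≡ Σ≤ n g
Σ≤-cong zero    f≗g = f≗g 0
Σ≤-cong (suc n) f≗g = cong₂ _+_ (Σ≤-cong n f≗g) (f≗g (suc n))

Σ≤-zero : ∀ n {f : ℕ → ℤ} → (∀ i → f i ≡ + 0) → Σ≤ n f ≡ + 0
Σ≤-zero zero    f≗0 = f≗0 0
Σ≤-zero (suc n) f≗0 = cong₂ _+_ (Σ≤-zero n f≗0) (f≗0 (suc n))

Σ≤-one : ∀ n → Σ≤ n (λ _ → + 1) ≡ + suc n
Σ≤-one zero    = refl
Σ≤-one (suc n) = trans (cong (_+ + 1) (Σ≤-one n)) (cong (+_ ∘ suc) (ℕP.+-comm n 1))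

Σ≤-split-head : ∀ n (f : ℕ → ℤ) → Σ≤ (suc n) f ≡ f 0 + Σ≤ n (f ∘ suc)
Σ≤-split-head zero    f = refl
Σ≤-split-head (suc n) f = begin
  Σ≤ (suc n) f + f (suc (suc n))               ≡⟨ cong (_+ f (suc (suc n))) (Σ≤-split-head n f) ⟩
  f 0 + Σ≤ n (f ∘ suc) + f (suc (suc n))       ≡⟨ ℤP.+-assoc (f 0) _ _ ⟩
  f 0 + Σ≤ (suc n) (f ∘ suc)                   ∎

⊗-congˡ : ∀ {F F′} H → F ≐ F′ → F ⊗ H ≐ F′ ⊗ H
⊗-congˡ H F≐F′ n = Σ≤-cong n (λ i → cong (_* H (n ∸ i)) (F≐F′ i))

⊗-sucˡ : ∀ F H n → (F ⊗ H) (suc n) ≡ F 0 * H (suc n) + ((F ∘ suc) ⊗ H) n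
⊗-sucˡ F H n = Σ≤-split-head n _

⊗-shiftˡ : ∀ F H → F 0 ≡ + 0 → ∀ n → (F ⊗ H) (suc n) ≡ ((F ∘ suc) ⊗ H) n
⊗-shiftˡ F H F0≡0 n = begin
  (F ⊗ H) (suc n)                         ≡⟨ ⊗-sucˡ F H n ⟩
  F 0 * H (suc n) + ((F ∘ suc) ⊗ H) n     ≡⟨ cong (λ a → a * H (suc n) + ((F ∘ suc) ⊗ H) n) F0≡0 ⟩
  + 0 + ((F ∘ suc) ⊗ H) n                 ≡⟨ ℤP.+-identityˡ _ ⟩
  ((F ∘ suc) ⊗ H) n                       ∎

⊗-monomialˡ : ∀ F H → (∀ i → F (suc i) ≡ + 0) → F ⊗ H ≐ (λ n → F 0 * H n)
⊗-monomialˡ F H F≗0 zero    = refl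
⊗-monomialˡ F H F≗0 (suc n) = begin
  (F ⊗ H) (suc n)                         ≡⟨ ⊗-sucˡ F H n ⟩
  F 0 * H (suc n) + ((F ∘ suc) ⊗ H) n     ≡⟨ cong (λ s → F 0 * H (suc n) + s) (Σ≤-zero n (λ i → cong (_* H (n ∸ i)) (F≗0 i))) ⟩
  F 0 * H (suc n) + + 0                   ≡⟨ ℤP.+-identityʳ _ ⟩
  F 0 * H (suc n)                         ∎

⊗-constˡ : ∀ c H → const c ⊗ H ≐ (λ n → c * H n)
⊗-constˡ c H = ⊗-monomialˡ (const c) H (λ _ → refl)

⊗-Xˡ-suc : ∀ H n → (X ⊗ H) (suc n) ≡ H n
⊗-Xˡ-suc H n = begin
  (X ⊗ H) (suc n)          ≡⟨ ⊗-shiftˡ X H refl n ⟩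
  ((X ∘ suc) ⊗ H) n        ≡⟨ ⊗-monomialˡ (X ∘ suc) H (λ _ → refl) n ⟩
  + 1 * H n                ≡⟨ ℤP.*-identityˡ (H n) ⟩
  H n                      ∎

double : ℕ → ℕ
double zero    = zero
double (suc k) = suc (suc (double k))

double≡+ : ∀ k → double k ≡ k ℕ.+ k
double≡+ zero    = refl
double≡+ (suc k) = cong suc (trans (cong suc (double≡+ k)) (sym (ℕP.+-suc k k)))

≤-double : ∀ k → k ≤ double k
≤-double zero    = z≤n
≤-double (suc k) = s≤s (ℕP.m≤n⇒m≤1+n (≤-double k))

data Parity : ℕ → Set where
  even : ∀ k → Parity (double k)
  odd  : ∀ k → Parity (suc (double k))

parity : ∀ n → Parity n
parity zero    = even 0
parity (suc n) with parity n
... | even k = odd k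
... | odd k  = even (suc k)

subst-x²-even : ∀ f k → subst-x² f (double k) ≡ f k
subst-x²-even f zero    = refl
subst-x²-even f (suc k) = subst-x²-even (f ∘ suc) k

subst-x²-odd : ∀ f k → subst-x² f (suc (double k)) ≡ + 0
subst-x²-odd f zero    = refl
subst-x²-odd f (suc k) = subst-x²-odd (f ∘ suc) k

module InverseOfOneMinusX² (G : Series) (G-inv : one-x² ⊗ G ≐ const (+ 1)) where

  G-0 : G 0 ≡ + 1
  G-0 = trans (sym (ℤP.*-identityˡ (G 0))) (G-inv 0)

  G-1 : G 1 ≡ + 0
  G-1 = trans (sym (trans (ℤP.+-identityʳ _) (ℤP.*-identityˡ (G 1)))) (G-inv 1)

  G-suc-suc : ∀ n → G (suc (suc n)) ≡ G n
  G-suc-suc n = ℤP.i-j≡0⇒i≡j _ _ (begin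
    G (suc (suc n)) - G n                                        ≡⟨ expand (G (suc (suc n))) (G (suc n)) (G n) ⟩
    + 1 * G (suc (suc n)) + (+ 0 * G (suc n) + - + 1 * G n)      ≡⟨ cong (λ s → + 1 * G (suc (suc n)) + s) tail ⟨
    + 1 * G (suc (suc n)) + ((one-x² ∘ suc) ⊗ G) (suc n)         ≡⟨ ⊗-sucˡ one-x² G (suc n) ⟨
    (one-x² ⊗ G) (suc (suc n))                                   ≡⟨ G-inv (suc (suc n)) ⟩
    + 0                                                          ∎)
    where
    expand : ∀ a b c → a - c ≡ + 1 * a + (+ 0 * b + - + 1 * c)
    expand = solve-∀
    tail : ((one-x² ∘ suc) ⊗ G) (suc n) ≡ + 0 * G (suc n) + - + 1 * G n
    tail = trans (⊗-sucˡ (one-x² ∘ suc) G n)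
                 (cong (λ s → + 0 * G (suc n) + s) (⊗-monomialˡ (one-x² ∘ suc ∘ suc) G (λ _ → refl) n))

  G-even : ∀ k → G (double k) ≡ + 1
  G-even zero    = G-0
  G-even (suc k) = trans (G-suc-suc (double k)) (G-even k)

  G-odd : ∀ k → G (suc (double k)) ≡ + 0
  G-odd zero    = G-1
  G-odd (suc k) = trans (G-suc-suc (suc (double k))) (G-odd k)

  G⊗-0 : ∀ F → (G ⊗ F) 0 ≡ F 0
  G⊗-0 F = trans (cong (_* F 0) G-0) (ℤP.*-identityˡ _)

  G⊗-1 : ∀ F → (G ⊗ F) 1 ≡ F 1
  G⊗-1 F = begin
    G 0 * F 1 + G 1 * F 0    ≡⟨ cong₂ (λ a b → a * F 1 + b * F 0) G-0 G-1 ⟩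
    + 1 * F 1 + + 0          ≡⟨ ℤP.+-identityʳ _ ⟩
    + 1 * F 1                ≡⟨ ℤP.*-identityˡ _ ⟩
    F 1                      ∎

  G⊗-suc-suc : ∀ F n → (G ⊗ F) (suc (suc n)) ≡ (G ⊗ F) n + F (suc (suc n))
  G⊗-suc-suc F n = begin
    (G ⊗ F) (suc (suc n))                                         ≡⟨ ⊗-sucˡ G F (suc n) ⟩
    G 0 * F (suc (suc n)) + ((G ∘ suc) ⊗ F) (suc n)               ≡⟨ cong₂ _+_ (trans (cong (_* _) G-0) (ℤP.*-identityˡ _))
                                                                               (⊗-sucˡ (G ∘ suc) F n) ⟩
    F (suc (suc n)) + (G 1 * F (suc n) + ((G ∘ suc ∘ suc) ⊗ F) n) ≡⟨ cong₂ (λ a b → F (suc (suc n)) + (a * F (suc n) + b))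
                                                                               G-1 (⊗-congˡ F G-suc-suc n) ⟩
    F (suc (suc n)) + (+ 0 + (G ⊗ F) n)                            ≡⟨ cong (_+_ (F (suc (suc n)))) (ℤP.+-identityˡ _) ⟩
    F (suc (suc n)) + (G ⊗ F) n                                    ≡⟨ ℤP.+-comm (F (suc (suc n))) _ ⟩
    (G ⊗ F) n + F (suc (suc n))                                    ∎

  G⊗-even : ∀ F k → (G ⊗ F) (double k) ≡ Σ≤ k (F ∘ double)
  G⊗-even F zero    = G⊗-0 F
  G⊗-even F (suc k) = trans (G⊗-suc-suc F (double k)) (cong (_+ _) (G⊗-even F k))

  G⊗-odd : ∀ F k → (G ⊗ F) (suc (double k)) ≡ Σ≤ k (F ∘ suc ∘ double)
  G⊗-odd F zero    = G⊗-1 F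
  G⊗-odd F (suc k) = trans (G⊗-suc-suc F (suc (double k))) (cong (_+ _) (G⊗-odd F k))

  G⊗subst-x²-even : ∀ f k → (G ⊗ subst-x² f) (double k) ≡ Σ≤ k f
  G⊗subst-x²-even f k = trans (G⊗-even (subst-x² f) k) (Σ≤-cong k (subst-x²-even f))

  G⊗subst-x²-odd : ∀ f k → (G ⊗ subst-x² f) (suc (double k)) ≡ + 0
  G⊗subst-x²-odd f k = trans (G⊗-odd (subst-x² f) k) (Σ≤-zero k (subst-x²-odd f))

  G⊗G-even : ∀ k → (G ⊗ G) (double k) ≡ + suc k
  G⊗G-even k = trans (G⊗-even G k) (trans (Σ≤-cong k G-even) (Σ≤-one k))

  G⊗G-odd : ∀ k → (G ⊗ G) (suc (double k)) ≡ + 0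
  G⊗G-odd k = trans (G⊗-odd G k) (Σ≤-zero k G-odd)

+m-+n≡+[m∸n] : ∀ {m n} → n ≤ m → + m - + n ≡ + (m ∸ n)
+m-+n≡+[m∸n] {m} {n} n≤m = trans (ℤP.m-n≡m⊖n m n) (ℤP.⊖-≥ n≤m)

module H₁Sequence (b : ℕ) (2≤b : 2 ≤ b) (h : ℤ → ℤ) (h-spec : IsH1 b h) where

  h-nonpos : ∀ n → n ℤ.≤ + 0 → h n ≡ + 1
  h-nonpos = proj₁ h-spec

  h-1 : h (+ 1) ≡ + b
  h-1 = proj₁ (proj₂ h-spec)

  h-rec : ∀ n → n ℤ.> + 1 → h n ≡ h (n - h (n - + 1)) + h (n - + 2)
  h-rec = proj₂ (proj₂ h-spec)

  h-0 : h (+ 0) ≡ + 1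
  h-0 = h-nonpos (+ 0) ℤP.≤-refl

  h-even-suc : ∀ k → + suc (suc (double k)) ℤ.≤ h (+ suc (double k)) →
               h (+ double (suc k)) ≡ + 1 + h (+ double k)
  h-even-suc k big = trans (h-rec _ (ℤ.+<+ (s≤s (s≤s z≤n))))
                           (cong (_+ h (+ double k)) (h-nonpos _ (ℤP.i≤j⇒i-j≤0 big)))

  h-odd-suc : ∀ k → h (+ double (suc k)) ≡ + suc (suc k) →
              h (+ suc (double (suc k))) ≡ h (+ suc k) + h (+ suc (double k))
  h-odd-suc k h-2k+2 = trans (h-rec _ (ℤ.+<+ (s≤s (s≤s z≤n))))
                             (cong (λ i → h i + h (+ suc (double k))) index)
    where
    index : + suc (double (suc k)) - h (+ double (suc k)) ≡ + suc k
    index = begin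
      + suc (double (suc k)) - h (+ double (suc k))   ≡⟨ cong (_-_ (+ suc (double (suc k)))) h-2k+2 ⟩
      + suc (double (suc k)) - + suc (suc k)          ≡⟨ +m-+n≡+[m∸n] (s≤s (s≤s (ℕP.m≤n⇒m≤1+n (≤-double k)))) ⟩
      + (suc (double k) ∸ k)                          ≡⟨ cong (λ m → + (suc m ∸ k)) (double≡+ k) ⟩
      + (suc k ℕ.+ k ∸ k)                             ≡⟨ cong +_ (ℕP.m+n∸n≡m (suc k) k) ⟩
      + suc k                                         ∎

  Shape : ℕ → Set
  Shape j = h (+ double j) ≡ + suc j × + suc (suc (double j)) ℤ.≤ h (+ suc (double j))

  2≤h : ∀ {n} → Parity n → (∀ {m} → m < n → Shape m) → 1 ≤ n → + 2 ℤ.≤ h (+ n)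
  2≤h (even zero)    _     ()
  2≤h (even (suc k)) shape _ =
    subst (+ 2 ℤ.≤_) (sym (proj₁ (shape {suc k} (s≤s (s≤s (≤-double k))))))
          (ℤ.+≤+ (s≤s (s≤s z≤n)))
  2≤h (odd k) shape _ =
    ℤP.≤-trans (ℤ.+≤+ (s≤s (s≤s z≤n))) (proj₂ (shape {k} (s≤s (≤-double k))))

  shape : ∀ j → Shape j
  shape = <-rec Shape step
    where
    step : ∀ j → (∀ {m} → m < j → Shape m) → Shape j
    step zero    _    = h-0 , subst (+ 2 ℤ.≤_) (sym h-1) (ℤ.+≤+ 2≤b)
    step (suc j) below = h-2j+2 , subst (_ ℤ.≤_) (sym (h-odd-suc j h-2j+2))
                                        (ℤP.+-mono-≤ (2≤h (parity (suc j)) below (s≤s z≤n)) big)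
      where
      big : + suc (suc (double j)) ℤ.≤ h (+ suc (double j))
      big = proj₂ (below {j} ℕP.≤-refl)
      h-2j+2 : h (+ double (suc j)) ≡ + suc (suc j)
      h-2j+2 = trans (h-even-suc j big) (cong (_+_ (+ 1)) (proj₁ (below {j} ℕP.≤-refl)))

  h-even : ∀ k → h (+ double k) ≡ + suc k
  h-even k = proj₁ (shape k)

  h-odd : ∀ k → h (+ suc (double k)) ≡ Σ≤ k (h ∘ +_) + (+ b - + 1)
  h-odd zero    = trans h-1 (trans (base (+ b)) (cong (λ a → a + (+ b - + 1)) (sym h-0)))
    where
    base : ∀ x → x ≡ + 1 + (x - + 1)
    base = solve-∀
  h-odd (suc k) = begin
    h (+ suc (double (suc k)))                       ≡⟨ h-odd-suc k (h-even (suc k)) ⟩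
    h (+ suc k) + h (+ suc (double k))               ≡⟨ cong (_+_ (h (+ suc k))) (h-odd k) ⟩
    h (+ suc k) + (Σ≤ k (h ∘ +_) + (+ b - + 1))      ≡⟨ regroup (h (+ suc k)) (Σ≤ k (h ∘ +_)) (+ b - + 1) ⟩
    Σ≤ k (h ∘ +_) + h (+ suc k) + (+ b - + 1)        ∎
    where
    regroup : ∀ x s c → x + (s + c) ≡ s + x + c
    regroup = solve-∀

X⊗G⊗F-suc : ∀ G F n → (X ⊗ G ⊗ F) (suc n) ≡ (G ⊗ F) n
X⊗G⊗F-suc G F n = trans (⊗-shiftˡ (X ⊗ G) F refl n) (⊗-congˡ F (⊗-Xˡ-suc G) n)

c⊗X-0 : ∀ c → (const c ⊗ X) 0 ≡ + 0
c⊗X-0 c = ℤP.*-zeroʳ c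

c⊗X⊗G-0 : ∀ c G → (const c ⊗ X ⊗ G) 0 ≡ + 0
c⊗X⊗G-0 c G = cong (_* G 0) (c⊗X-0 c)

c⊗X⊗G-suc : ∀ c G n → (const c ⊗ X ⊗ G) (suc n) ≡ c * G n
c⊗X⊗G-suc c G n = begin
  (const c ⊗ X ⊗ G) (suc n)                ≡⟨ ⊗-shiftˡ (const c ⊗ X) G (c⊗X-0 c) n ⟩
  (((const c ⊗ X) ∘ suc) ⊗ G) n              ≡⟨ ⊗-monomialˡ ((const c ⊗ X) ∘ suc) G (λ i → trans (⊗-constˡ c X (suc (suc i))) (ℤP.*-zeroʳ c)) n ⟩
  (const c ⊗ X) 1 * G n                    ≡⟨ cong (_* G n) (trans (⊗-constˡ c X 1) (ℤP.*-identityʳ c)) ⟩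
  c * G n                                  ∎

module Coefficients (b : ℕ) (2≤b : 2 ≤ b) (h : ℤ → ℤ) (h-spec : IsH1 b h)
                    (G : Series) (G-inv : one-x² ⊗ G ≐ const (+ 1)) where

  open InverseOfOneMinusX² G G-inv
  open H₁Sequence b 2≤b h h-spec

  c : ℤ
  c = + b - + 1

  S : Series
  S = subst-x² (genH h)

  coefficient : ∀ {n} → Parity n → h (+ n) ≡ (X ⊗ G ⊗ S) n + (const c ⊗ X ⊗ G) n + (G ⊗ G) n
  coefficient (even zero) = sym (begin
    + 0 + (const c ⊗ X ⊗ G) 0 + (G ⊗ G) 0
      ≡⟨ cong₂ (λ t v → + 0 + t + v) (c⊗X⊗G-0 c G) (G⊗G-even 0) ⟩
    + 1
      ≡⟨ h-0 ⟨
    h (+ 0)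
      ∎)
  coefficient (even (suc k)) = sym (begin
    (X ⊗ G ⊗ S) (suc n) + (const c ⊗ X ⊗ G) (suc n) + (G ⊗ G) (suc (suc (double k)))
      ≡⟨ cong₂ _+_ (cong₂ _+_ (trans (X⊗G⊗F-suc G S n) (G⊗subst-x²-odd (genH h) k))
                              (trans (c⊗X⊗G-suc c G n) (trans (cong (c *_) (G-odd k)) (ℤP.*-zeroʳ c))))
                   (G⊗G-even (suc k)) ⟩
    + suc (suc k)
      ≡⟨ h-even (suc k) ⟨
    h (+ double (suc k))
      ∎)
    where n = suc (double k)
  coefficient (odd k) = sym (begin
    (X ⊗ G ⊗ S) (suc n) + (const c ⊗ X ⊗ G) (suc n) + (G ⊗ G) (suc n)
      ≡⟨ cong₂ _+_ (cong₂ _+_ (trans (X⊗G⊗F-suc G S n) (G⊗subst-x²-even (genH h) k))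
                              (trans (c⊗X⊗G-suc c G n) (trans (cong (c *_) (G-even k)) (ℤP.*-identityʳ c))))
                   (G⊗G-odd k) ⟩
    Σ≤ k (h ∘ +_) + c + + 0
      ≡⟨ ℤP.+-identityʳ _ ⟩
    Σ≤ k (h ∘ +_) + c
      ≡⟨ h-odd k ⟨
    h (+ suc (double k))
      ∎)
    where n = double k

theorem4p2 : (b : ℕ) → 2 ≤ b → (h : ℤ → ℤ) → IsH1 b h →
    (G : Series) → one-x² ⊗ G ≐ const (+ 1) →
    genH h ≐ X ⊗ G ⊗ subst-x² (genH h) ⊕ const (+ b - + 1) ⊗ X ⊗ G ⊕ G ⊗ G
theorem4p2 b 2≤b h h-spec G G-inv n = coefficient (parity n)
  where open Coefficients b 2≤b h h-spec G G-inv
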